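{- $\big[\Box(p\vee q)\wedge(\Box p\vee\Box\Diamond\neg p)\wedge(\Box q\vee\Box\Diamond\neg q)\big]\to(\Box p\vee\Box q)\in\mathsf{Grz}$.
   Context: Formulas are built from propositional variables with $\wedge,\vee,\to,\bot,\Box$; $\neg\varphi:=\varphi\to\bot$, $\Diamond\varphi:=\neg\Box\neg\varphi$. $\mathsf{S4}$ is the least set of such formulas containing the axioms of classical propositional logic, $\Box(p\to p)$, $(\Box p\wedge\Box q)\to\Box(p\wedge q)$, $\Box p\to p$, $\Box p\to\Box\Box p$, and closed under substitution, modus ponens and the rule from $\varphi\to\psi$ infer $\Box\varphi\to\Box\psi$. Grzegorczyk's logic $\mathsf{Grz}$ is the least such set containing $\mathsf{S4}$ and $\Box(\Box(p\to\Box p)\to p)\to p$. -}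

module Defs where

open import Data.Nat using (ℕ)
open import Data.Bool using (Bool; true; false; _∧_; _∨_; not)

data Fm : Set where
  var  : ℕ → Fm
  _∧'_ : Fm → Fm → Fm
  _∨'_ : Fm → Fm → Fm
  _⇒_  : Fm → Fm → Fm
  ⊥'   : Fm
  □    : Fm → Fm

infixr 6 _∧'_
infixr 5 _∨'_
infixr 4 _⇒_

¬' : Fm → Fm
¬' φ = φ ⇒ ⊥'

◇ : Fm → Fm
◇ φ = ¬' (□ (¬' φ))

-- Classical Boolean evaluation, treating □-formulas as atoms
-- (used to define the axioms of classical propositional logic:
--  all substitution instances of propositional tautologies).
_⇒b_ : Bool → Bool → Bool
a ⇒b b = not a ∨ b

evalB : (ℕ → Bool) → (Fm → Bool) → Fm → Bool
evalB v w (var n)   = v n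
evalB v w (φ ∧' ψ)  = evalB v w φ ∧ evalB v w ψ
evalB v w (φ ∨' ψ)  = evalB v w φ ∨ evalB v w ψ
evalB v w (φ ⇒ ψ)   = evalB v w φ ⇒b evalB v w ψ
evalB v w ⊥'        = false
evalB v w (□ φ)     = w (□ φ)

open import Relation.Binary.PropositionalEquality using (_≡_)

Tautology : Fm → Set
Tautology φ = (v : ℕ → Bool) (w : Fm → Bool) → evalB v w φ ≡ true

subst' : (ℕ → Fm) → Fm → Fm
subst' σ (var n)  = σ n
subst' σ (φ ∧' ψ) = subst' σ φ ∧' subst' σ ψ
subst' σ (φ ∨' ψ) = subst' σ φ ∨' subst' σ ψ
subst' σ (φ ⇒ ψ)  = subst' σ φ ⇒ subst' σ ψ
subst' σ ⊥'       = ⊥'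
subst' σ (□ φ)    = □ (subst' σ φ)

p q : Fm
p = var 0
q = var 1

data Grz : Fm → Set where
  taut  : ∀ {φ} → Tautology φ → Grz φ
  ax-N  : Grz (□ (p ⇒ p))
  ax-C  : Grz ((□ p ∧' □ q) ⇒ □ (p ∧' q))
  ax-T  : Grz (□ p ⇒ p)
  ax-4  : Grz (□ p ⇒ □ (□ p))
  ax-G  : Grz (□ (□ (p ⇒ □ p) ⇒ p) ⇒ p)
  sub   : ∀ {φ} (σ : ℕ → Fm) → Grz φ → Grz (subst' σ φ)
  mp    : ∀ {φ ψ} → Grz (φ ⇒ ψ) → Grz φ → Grz ψ
  mono  : ∀ {φ ψ} → Grz (φ ⇒ ψ) → Grz (□ φ ⇒ □ ψ)

-- With Γ = □(p ∨ q) ∧ □◇¬p ∧ □◇¬q the claim follows propositionally from ⊢ ¬Γ.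
-- Γ is boxed (Γ → □Γ by 4). Under Γ, the Grz premise □(p → □p) together with
-- □◇¬p gives □¬p (inside the box, p → □p contradicts ◇¬p), hence □q by □(p ∨ q),
-- contradicting ◇¬q. So Γ ⊢ □(p → □p) → p, and since Γ is boxed the Grz axiom
-- yields Γ ⊢ p, then Γ ⊢ □p, contradicting ◇¬p.

module Submission where

open import Defs
open import Data.Bool using (Bool; true; false; T; _∧_; _∨_)
open import Data.Bool.Properties using (T-∧; T-≡)
open import Data.Nat using (ℕ; zero; suc; _<ᵇ_)
open import Data.List using (List; []; _∷_; length)
open import Data.Product using (_,_)
open import Function using (_∘_)
open import Function.Bundles using (Equivalence)
open import Relation.Binary.PropositionalEquality using (_≡_; refl; sym; trans; cong₂)

open Equivalence using (to)

_∷ᵛ_ : Bool → (ℕ → Bool) → ℕ → Bool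
(b ∷ᵛ v) zero    = b
(b ∷ᵛ v) (suc n) = v n

restrict : ℕ → (ℕ → Bool) → ℕ → Bool
restrict zero    v = λ _ → false
restrict (suc k) v = v 0 ∷ᵛ restrict k (v ∘ suc)

restrict-agrees : ∀ k v n → T (n <ᵇ k) → restrict k v n ≡ v n
restrict-agrees (suc k) v zero    _   = refl
restrict-agrees (suc k) v (suc n) n<k = restrict-agrees k (v ∘ suc) n n<k

allValuations : ℕ → ((ℕ → Bool) → Bool) → Bool
allValuations zero    f = f (λ _ → false)
allValuations (suc k) f =
  allValuations k (f ∘ (true ∷ᵛ_)) ∧ allValuations k (f ∘ (false ∷ᵛ_))

allValuations-sound : ∀ k f → T (allValuations k f) → ∀ v → T (f (restrict k v))
allValuations-sound zero    f ok v = ok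
allValuations-sound (suc k) f ok v with v 0 | to T-∧ ok
... | true  | ok-true , _  = allValuations-sound k (f ∘ (true ∷ᵛ_)) ok-true (v ∘ suc)
... | false | _ , ok-false = allValuations-sound k (f ∘ (false ∷ᵛ_)) ok-false (v ∘ suc)

propositionalBelow : ℕ → Fm → Bool
propositionalBelow k (var n)  = n <ᵇ k
propositionalBelow k (φ ∧' ψ) = propositionalBelow k φ ∧ propositionalBelow k ψ
propositionalBelow k (φ ∨' ψ) = propositionalBelow k φ ∧ propositionalBelow k ψ
propositionalBelow k (φ ⇒ ψ)  = propositionalBelow k φ ∧ propositionalBelow k ψ
propositionalBelow k ⊥'       = true
propositionalBelow k (□ φ)    = false

evalB-restrict : ∀ k φ → T (propositionalBelow k φ) →
                 ∀ v w w′ → evalB v w φ ≡ evalB (restrict k v) w′ φ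
evalB-restrict k (var n)  prop v w w′ = sym (restrict-agrees k v n prop)
evalB-restrict k (φ ∧' ψ) prop v w w′ with to T-∧ prop
... | pφ , pψ = cong₂ _∧_ (evalB-restrict k φ pφ v w w′) (evalB-restrict k ψ pψ v w w′)
evalB-restrict k (φ ∨' ψ) prop v w w′ with to T-∧ prop
... | pφ , pψ = cong₂ _∨_ (evalB-restrict k φ pφ v w w′) (evalB-restrict k ψ pψ v w w′)
evalB-restrict k (φ ⇒ ψ)  prop v w w′ with to T-∧ prop
... | pφ , pψ = cong₂ _⇒b_ (evalB-restrict k φ pφ v w w′) (evalB-restrict k ψ pψ v w w′)
evalB-restrict k ⊥'       prop v w w′ = refl

validBelow : ℕ → Fm → Bool
validBelow k φ = allValuations k (λ v → evalB v (λ _ → false) φ)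

tautology : ∀ k φ → T (propositionalBelow k φ) → T (validBelow k φ) → Tautology φ
tautology k φ prop valid v w =
  trans (evalB-restrict k φ prop v w (λ _ → false))
        (to T-≡ (allValuations-sound k (λ v → evalB v (λ _ → false) φ) valid v))

-- Variables beyond the list are sent to ⊥'; schemata never mention them.
listSubst : List Fm → ℕ → Fm
listSubst []       n       = ⊥'
listSubst (A ∷ As) zero    = A
listSubst (A ∷ As) (suc n) = listSubst As n

-- On a closed schema both side conditions normalise to ⊤, so Agda discharges
-- them by evaluating the truth table.
tautologyInstance : ∀ φ As
                    {_ : T (propositionalBelow (length As) φ)}
                    {_ : T (validBelow (length As) φ)} →
                    Grz (subst' (listSubst As) φ)
tautologyInstance φ As {prop} {valid} =
  sub {φ} (listSubst As) (taut {φ} (tautology (length As) φ prop valid))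

x₀ x₁ x₂ x₃ x₄ : Fm
x₀ = var 0
x₁ = var 1
x₂ = var 2
x₃ = var 3
x₄ = var 4

⇒-trans : ∀ {A B C} → Grz (A ⇒ B) → Grz (B ⇒ C) → Grz (A ⇒ C)
⇒-trans {A} {B} {C} A⇒B B⇒C =
  mp (mp (tautologyInstance ((x₀ ⇒ x₁) ⇒ (x₁ ⇒ x₂) ⇒ x₀ ⇒ x₂) (A ∷ B ∷ C ∷ [])) A⇒B) B⇒C

⇒-∧ : ∀ {A B C} → Grz (A ⇒ B) → Grz (A ⇒ C) → Grz (A ⇒ B ∧' C)
⇒-∧ {A} {B} {C} A⇒B A⇒C =
  mp (mp (tautologyInstance ((x₀ ⇒ x₁) ⇒ (x₀ ⇒ x₂) ⇒ x₀ ⇒ x₁ ∧' x₂) (A ∷ B ∷ C ∷ [])) A⇒B) A⇒C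

∧-proj₁ : ∀ {A B} → Grz (A ∧' B ⇒ A)
∧-proj₁ {A} {B} = tautologyInstance (x₀ ∧' x₁ ⇒ x₀) (A ∷ B ∷ [])

∧-proj₂ : ∀ {A B} → Grz (A ∧' B ⇒ B)
∧-proj₂ {A} {B} = tautologyInstance (x₀ ∧' x₁ ⇒ x₁) (A ∷ B ∷ [])

curry : ∀ {A B C} → Grz (A ∧' B ⇒ C) → Grz (A ⇒ B ⇒ C)
curry {A} {B} {C} = mp (tautologyInstance ((x₀ ∧' x₁ ⇒ x₂) ⇒ x₀ ⇒ x₁ ⇒ x₂) (A ∷ B ∷ C ∷ []))

⊥-elim : ∀ {A} → Grz (⊥' ⇒ A)
⊥-elim {A} = tautologyInstance (⊥' ⇒ x₀) (A ∷ [])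

contradiction : ∀ {Γ A} → Grz (Γ ⇒ A) → Grz (Γ ⇒ ¬' A) → Grz (Γ ⇒ ⊥')
contradiction {Γ} {A} Γ⇒A Γ⇒¬A =
  mp (mp (tautologyInstance ((x₀ ⇒ x₁) ⇒ (x₀ ⇒ ¬' x₁) ⇒ ¬' x₀) (Γ ∷ A ∷ [])) Γ⇒A) Γ⇒¬A

¬¬-intro : ∀ {A} → Grz (A ⇒ ¬' (¬' A))
¬¬-intro {A} = tautologyInstance (x₀ ⇒ ¬' (¬' x₀)) (A ∷ [])

disjunctive-syllogism : ∀ {A B} → Grz (¬' A ∧' (A ∨' B) ⇒ B)
disjunctive-syllogism {A} {B} = tautologyInstance (¬' x₀ ∧' (x₀ ∨' x₁) ⇒ x₁) (A ∷ B ∷ [])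

modus-tollens : ∀ {A B C} → Grz (B ⇒ C) → Grz ((A ⇒ B) ∧' ¬' C ⇒ ¬' A)
modus-tollens {A} {B} {C} =
  mp (tautologyInstance ((x₁ ⇒ x₂) ⇒ (x₀ ⇒ x₁) ∧' ¬' x₂ ⇒ ¬' x₀) (A ∷ B ∷ C ∷ []))

□-T : ∀ {A} → Grz (□ A ⇒ A)
□-T {A} = sub (listSubst (A ∷ [])) ax-T

□-4 : ∀ {A} → Grz (□ A ⇒ □ (□ A))
□-4 {A} = sub (listSubst (A ∷ [])) ax-4

□-∧ : ∀ {Γ A B} → Grz (Γ ⇒ □ A) → Grz (Γ ⇒ □ B) → Grz (Γ ⇒ □ (A ∧' B))
□-∧ {A = A} {B} Γ⇒□A Γ⇒□B = ⇒-trans (⇒-∧ Γ⇒□A Γ⇒□B) (sub (listSubst (A ∷ B ∷ [])) ax-C)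

□-◇¬-contradiction : ∀ {Γ A} → Grz (Γ ⇒ □ A) → Grz (Γ ⇒ ◇ (¬' A)) → Grz (Γ ⇒ ⊥')
□-◇¬-contradiction Γ⇒□A = contradiction (⇒-trans Γ⇒□A (mono ¬¬-intro))

Boxed : Fm → Set
Boxed Γ = Grz (Γ ⇒ □ Γ)

□-boxed : ∀ {A} → Boxed (□ A)
□-boxed = □-4

∧-boxed : ∀ {A B} → Boxed A → Boxed B → Boxed (A ∧' B)
∧-boxed A⇒□A B⇒□B = □-∧ (⇒-trans ∧-proj₁ A⇒□A) (⇒-trans ∧-proj₂ B⇒□B)

boxed-necessitation : ∀ {Γ A} → Boxed Γ → Grz (Γ ⇒ A) → Grz (Γ ⇒ □ A)
boxed-necessitation Γ⇒□Γ Γ⇒A = ⇒-trans Γ⇒□Γ (mono Γ⇒A)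

grz-rule : ∀ {Γ A} → Boxed Γ → Grz (Γ ⇒ □ (A ⇒ □ A) ⇒ A) → Grz (Γ ⇒ A)
grz-rule {A = A} Γ⇒□Γ Γ⇒premise =
  ⇒-trans (boxed-necessitation Γ⇒□Γ Γ⇒premise) (sub (listSubst (A ∷ [])) ax-G)

□-disjunctive-syllogism : ∀ {A B} → Grz (□ (¬' A) ∧' □ (A ∨' B) ⇒ □ B)
□-disjunctive-syllogism = ⇒-trans (□-∧ ∧-proj₁ ∧-proj₂) (mono disjunctive-syllogism)

□-fixed-◇¬-refutes : ∀ {A} → Grz (□ (A ⇒ □ A) ∧' □ (◇ (¬' A)) ⇒ □ (¬' A))
□-fixed-◇¬-refutes = ⇒-trans (□-∧ ∧-proj₁ ∧-proj₂) (mono (modus-tollens (mono ¬¬-intro)))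

□∨-□◇¬-□◇¬-inconsistent :
  ∀ A B → Grz (□ (A ∨' B) ∧' □ (◇ (¬' A)) ∧' □ (◇ (¬' B)) ⇒ ⊥')
□∨-□◇¬-□◇¬-inconsistent A B = □-◇¬-contradiction Γ⇒□A (⇒-trans Γ⇒□◇¬A □-T)
  where
  Γ : Fm
  Γ = □ (A ∨' B) ∧' □ (◇ (¬' A)) ∧' □ (◇ (¬' B))

  Γ-boxed : Boxed Γ
  Γ-boxed = ∧-boxed □-boxed (∧-boxed □-boxed □-boxed)

  Γ⇒□∨ : Grz (Γ ⇒ □ (A ∨' B))
  Γ⇒□∨ = ∧-proj₁

  Γ⇒□◇¬A : Grz (Γ ⇒ □ (◇ (¬' A)))
  Γ⇒□◇¬A = ⇒-trans ∧-proj₂ ∧-proj₁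

  Γ⇒□◇¬B : Grz (Γ ⇒ □ (◇ (¬' B)))
  Γ⇒□◇¬B = ⇒-trans ∧-proj₂ ∧-proj₂

  Γ,fixed⇒□¬A : Grz (Γ ∧' □ (A ⇒ □ A) ⇒ □ (¬' A))
  Γ,fixed⇒□¬A = ⇒-trans (⇒-∧ ∧-proj₂ (⇒-trans ∧-proj₁ Γ⇒□◇¬A)) □-fixed-◇¬-refutes

  Γ,fixed⇒□B : Grz (Γ ∧' □ (A ⇒ □ A) ⇒ □ B)
  Γ,fixed⇒□B = ⇒-trans (⇒-∧ Γ,fixed⇒□¬A (⇒-trans ∧-proj₁ Γ⇒□∨)) □-disjunctive-syllogism

  Γ,fixed⇒⊥ : Grz (Γ ∧' □ (A ⇒ □ A) ⇒ ⊥')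
  Γ,fixed⇒⊥ = □-◇¬-contradiction Γ,fixed⇒□B (⇒-trans ∧-proj₁ (⇒-trans Γ⇒□◇¬B □-T))

  Γ⇒□A : Grz (Γ ⇒ □ A)
  Γ⇒□A = boxed-necessitation Γ-boxed (grz-rule Γ-boxed (curry (⇒-trans Γ,fixed⇒⊥ ⊥-elim)))

lemma3p2p3 : Grz ((□ (p ∨' q) ∧' (□ p ∨' □ (◇ (¬' p))) ∧' (□ q ∨' □ (◇ (¬' q)))) ⇒ (□ p ∨' □ q))
lemma3p2p3 =
  mp (tautologyInstance
        ((x₀ ∧' x₂ ∧' x₄ ⇒ ⊥') ⇒ x₀ ∧' (x₁ ∨' x₂) ∧' (x₃ ∨' x₄) ⇒ x₁ ∨' x₃)
        (□ (p ∨' q) ∷ □ p ∷ □ (◇ (¬' p)) ∷ □ q ∷ □ (◇ (¬' q)) ∷ []))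
     (□∨-□◇¬-□◇¬-inconsistent p q)
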